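{- Let $\mathbb{F}_q$ be a finite field of odd characteristic and $c\in\mathbb{F}_q$ nonzero. Let $f:\mathbb{F}_q\to\mathbb{F}_q$ be $f(R)=R(4c-R)$ and $S=\{R\in\mathbb{F}_q: f(R) \text{ is not a square in } \mathbb{F}_q\}$ (so $0\notin S$). Then it is possible to pack $k$ distinct pairwise disjoint circles of radius $c$ in the plane $\mathbb{F}_q^2$ with nonzero distance between any two centers if and only if there exist $k$ distinct points of $\mathbb{F}_q^2$ (vertices of a $(k-1)$-simplex) all of whose pairwise distances lie in $S$. In that case, the packing is achieved by placing the $k$ circles of radius $c$ centered at these $k$ points.
   Context: For $v=(v_1,v_2)\in\mathbb{F}_q^2$, $\|v\|=v_1^2+v_2^2$, and the distance between points $x,y$ is $\|x-y\|$. The circle of radius $R$ and center $u$ is $\{x\in\mathbb{F}_q^2: \|x-u\|=R\}$. A packing of circles means a collection of pairwise disjoint circles. -}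

module Defs where

open import Level using (Level; _⊔_; suc)
open import Algebra.Bundles using (CommutativeRing)
open import Data.Nat as ℕ using (ℕ; zero; _<_; _%_)
import Data.Nat as N
open import Data.Fin using (Fin)
open import Data.List using (List)
open import Data.List.Membership.Setoid using () renaming (_∈_ to _∈ₛ_)
open import Data.Product using (Σ; ∃; _×_; _,_)
open import Relation.Binary.PropositionalEquality using (_≡_)
open import Relation.Nullary using (¬_)

record IsFieldR {c ℓ : Level} (R : CommutativeRing c ℓ) : Set (c ⊔ ℓ) where
  open CommutativeRing R
  field
    1≉0     : ¬ (1# ≈ 0#)
    inverse : ∀ x → ¬ (x ≈ 0#) → ∃ λ y → (x * y) ≈ 1#

IsFinite : {c ℓ : Level} (R : CommutativeRing c ℓ) → Set (c ⊔ ℓ)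
IsFinite R = ∃ λ (xs : List Carrier) → ∀ x → _∈ₛ_ setoid x xs
  where open CommutativeRing R

module FieldNotions {c ℓ : Level} (R : CommutativeRing c ℓ) where
  open CommutativeRing R

  _·1 : ℕ → Carrier
  zero ·1 = 0#
  N.suc n ·1 = 1# + (n ·1)

  HasCharacteristic : ℕ → Set ℓ
  HasCharacteristic p =
    (0 < p) × ((p ·1) ≈ 0#) × (∀ m → 0 < m → m < p → ¬ ((m ·1) ≈ 0#))

  OddCharacteristic : Set ℓ
  OddCharacteristic = ∃ λ p → HasCharacteristic p × (p % 2 ≡ 1)

  IsSquare : Carrier → Set (c ⊔ ℓ)
  IsSquare a = ∃ λ y → (y * y) ≈ a

  Point : Set c
  Point = Carrier × Carrier

  norm : Point → Carrier
  norm (v₁ , v₂) = (v₁ * v₁) + (v₂ * v₂)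

  dist : Point → Point → Carrier
  dist (x₁ , x₂) (y₁ , y₂) = norm ((x₁ - y₁) , (x₂ - y₂))

  OnCircle : Carrier → Point → Point → Set ℓ
  OnCircle r u x = dist x u ≈ r

  _≈ₚ_ : Point → Point → Set ℓ
  (x₁ , x₂) ≈ₚ (y₁ , y₂) = (x₁ ≈ y₁) × (x₂ ≈ y₂)

  f : Carrier → Carrier → Carrier
  f cc r = r * (((4 ·1) * cc) - r)

  InS : Carrier → Carrier → Set (c ⊔ ℓ)
  InS cc r = ¬ IsSquare (f cc r)

  PairwiseDisjointCircles : {k : ℕ} → Carrier → (Fin k → Point) → Set (c ⊔ ℓ)
  PairwiseDisjointCircles r u =
    ∀ i j → ¬ (i ≡ j) → ∀ x → ¬ (OnCircle r (u i) x × OnCircle r (u j) x)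

  NonzeroCenterDistances : {k : ℕ} → (Fin k → Point) → Set ℓ
  NonzeroCenterDistances u = ∀ i j → ¬ (i ≡ j) → ¬ (dist (u i) (u j) ≈ 0#)

  DistinctCircles : {k : ℕ} → Carrier → (Fin k → Point) → Set (c ⊔ ℓ)
  DistinctCircles r u =
    ∀ i j → ¬ (i ≡ j) →
      ¬ (∀ x → (OnCircle r (u i) x → OnCircle r (u j) x)
                × (OnCircle r (u j) x → OnCircle r (u i) x))

  CirclePacking : (k : ℕ) → Carrier → (Fin k → Point) → Set (c ⊔ ℓ)
  CirclePacking k r u =
    DistinctCircles r u × PairwiseDisjointCircles r u × NonzeroCenterDistances u

  SimplexInS : (k : ℕ) → Carrier → (Fin k → Point) → Set (c ⊔ ℓ)
  SimplexInS k cc p =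
    (∀ i j → ¬ (i ≡ j) → ¬ (p i ≈ₚ p j)) ×
    (∀ i j → ¬ (i ≡ j) → InS cc (dist (p i) (p j)))

-- Two circles of radius r about u and v, with D = ‖u − v‖ ≠ 0, meet exactly
-- when f(r, D) = D(4r − D) is a square. If x is a common point then
-- (2 det(x − u, v − u))² = 4‖x − u‖D − (‖x − u‖ + D − ‖x − v‖)² = D(4r − D);
-- conversely, if s² = D(4r − D), the point u + (v − u)/2 + (s/2D)(v − u)^⊥
-- lies on both circles. Hence disjointness of the circles is the condition that
-- all centre distances lie in S, and the nonzero-distance conditions are
-- bookkeeping (f(r, 0) = 0 is a square). The one remaining point is that
-- distinct centres give distinct circles, which needs every circle to be
-- nonempty: in a finite field every c is a sum of two squares, because the
-- (q + 1)/2 squares a² and the (q + 1)/2 values c − b² cannot be disjoint.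
module Submission where

open import Defs
open import Level using (Level)
open import Algebra.Bundles using (CommutativeRing)
open import Data.Empty using (⊥; ⊥-elim)
open import Data.Fin as Fin using (Fin; zero; suc)
import Data.Fin.Properties as Finₚ
open import Data.Integer as ℤ using (ℤ; +_; -[1+_]; _⊖_; sign; ∣_∣)
import Data.Integer.Properties as ℤₚ
open import Data.List using (List; []; _∷_; length; lookup; deduplicate)
import Data.List.Membership.Propositional.Properties as ∈ₚ
open import Data.List.Membership.Setoid.Properties using (index-injective)
open import Data.List.Relation.Unary.All as All using (All; []; _∷_)
import Data.List.Relation.Unary.Any as Any
open import Data.List.Relation.Unary.Any.Properties using (lookup-index)
open import Data.List.Relation.Unary.Enumerates.Setoid using (IsEnumeration)
open import Data.List.Relation.Unary.Enumerates.Setoid.Properties using (deduplicate⁺)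
open import Data.List.Relation.Unary.Unique.DecSetoid.Properties using (deduplicate-!)
open import Data.List.Relation.Unary.Unique.Setoid using (Unique; []; _∷_)
open import Data.Maybe using (Maybe; just; nothing)
open import Data.Nat as ℕ using (ℕ; zero; suc; z≤n; s≤s)
import Data.Nat.Properties as ℕₚ
open import Data.Product using (∃; ∃₂; _×_; _,_; proj₁; proj₂)
open import Data.Sign as Sign using (Sign)
open import Function using (_∘_)
open import Relation.Binary.Bundles using (Setoid; DecSetoid)
open import Relation.Binary.Definitions using (Decidable; _Respects_)
open import Relation.Binary.PropositionalEquality as ≡ using (_≡_; _≢_)
open import Relation.Nullary using (¬_; Dec; yes; no; contradiction)
open import Relation.Nullary.Negation using (¬¬-map)
open import Relation.Nullary.Decidable using (¬¬-excluded-middle)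
import Relation.Nullary.Decidable as Dec
import Algebra.Solver.Ring.AlmostCommutativeRing as ACR

-- The ring solver needs coefficients with decidable equality, and the carrier
-- has none; ℤ maps into every commutative ring.
module IntegerCoefficients {r ℓ : Level} (R : CommutativeRing r ℓ) where
  open CommutativeRing R
  open import Algebra.Properties.Semiring.Mult semiring
    using (×-homo-+; ×-congˡ; ×1-homo-*) renaming (_×_ to _×ₙ_)
  open import Algebra.Properties.Ring ring using (-‿distribˡ-*; -‿distribʳ-*; -0#≈0#; -‿involutive)
  open import Algebra.Properties.AbelianGroup +-abelianGroup using (⁻¹-∙-comm)
  open import Algebra.Properties.CommutativeSemigroup +-commutativeSemigroup using (interchange)
  open import Relation.Binary.Reasoning.Setoid setoid

  fromℤ : ℤ → Carrier
  fromℤ (+ n) = n ×ₙ 1#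
  fromℤ -[1+ n ] = - (suc n ×ₙ 1#)

  signed : Sign → Carrier → Carrier
  signed Sign.+ x = x
  signed Sign.- x = - x

  signed-cong : ∀ s {x y} → x ≈ y → signed s x ≈ signed s y
  signed-cong Sign.+ x≈y = x≈y
  signed-cong Sign.- x≈y = -‿cong x≈y

  signed-* : ∀ s t x y → signed (s Sign.* t) (x * y) ≈ signed s x * signed t y
  signed-* Sign.+ Sign.+ x y = refl
  signed-* Sign.+ Sign.- x y = -‿distribʳ-* x y
  signed-* Sign.- Sign.+ x y = -‿distribˡ-* x y
  signed-* Sign.- Sign.- x y = begin
    x * y         ≈⟨ sym (-‿involutive _) ⟩
    - - (x * y)   ≈⟨ -‿cong (-‿distribʳ-* x y) ⟩
    - (x * - y)   ≈⟨ -‿distribˡ-* x (- y) ⟩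
    - x * - y     ∎

  fromℤ-signAbs : ∀ i → fromℤ i ≈ signed (sign i) (∣ i ∣ ×ₙ 1#)
  fromℤ-signAbs (+ n) = refl
  fromℤ-signAbs -[1+ n ] = refl

  fromℤ-◃ : ∀ s n → fromℤ (s ℤ.◃ n) ≈ signed s (n ×ₙ 1#)
  fromℤ-◃ Sign.+ zero = refl
  fromℤ-◃ Sign.- zero = sym -0#≈0#
  fromℤ-◃ Sign.+ (suc n) = refl
  fromℤ-◃ Sign.- (suc n) = refl

  x-y≈[z+x]-[z+y] : ∀ x y z → x - y ≈ (z + x) - (z + y)
  x-y≈[z+x]-[z+y] x y z = begin
    x - y                 ≈⟨ sym (+-identityˡ _) ⟩
    0# + (x - y)          ≈⟨ +-congʳ (sym (-‿inverseʳ z)) ⟩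
    (z - z) + (x - y)     ≈⟨ interchange z (- z) x (- y) ⟩
    (z + x) + (- z - y)   ≈⟨ +-congˡ (⁻¹-∙-comm z y) ⟩
    (z + x) - (z + y)     ∎

  fromℤ-⊖ : ∀ m n → fromℤ (m ⊖ n) ≈ (m ×ₙ 1#) - (n ×ₙ 1#)
  fromℤ-⊖ zero zero = sym (-‿inverseʳ 0#)
  fromℤ-⊖ zero (suc n) = sym (+-identityˡ _)
  fromℤ-⊖ (suc m) zero = sym (trans (+-congˡ -0#≈0#) (+-identityʳ _))
  fromℤ-⊖ (suc m) (suc n) rewrite ℤₚ.[1+m]⊖[1+n]≡m⊖n m n =
    trans (fromℤ-⊖ m n) (x-y≈[z+x]-[z+y] (m ×ₙ 1#) (n ×ₙ 1#) 1#)

  fromℤ-+ : ∀ i j → fromℤ (i ℤ.+ j) ≈ fromℤ i + fromℤ j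
  fromℤ-+ (+ m) (+ n) = ×-homo-+ 1# m n
  fromℤ-+ (+ m) -[1+ n ] = fromℤ-⊖ m (suc n)
  fromℤ-+ -[1+ m ] (+ n) = trans (fromℤ-⊖ n (suc m)) (+-comm _ _)
  fromℤ-+ -[1+ m ] -[1+ n ] = begin
    - (suc (suc (m ℕ.+ n)) ×ₙ 1#)      ≈⟨ -‿cong (×-congˡ (≡.cong suc (≡.sym (ℕₚ.+-suc m n)))) ⟩
    - ((suc m ℕ.+ suc n) ×ₙ 1#)        ≈⟨ -‿cong (×-homo-+ 1# (suc m) (suc n)) ⟩
    - ((suc m ×ₙ 1#) + (suc n ×ₙ 1#))  ≈⟨ sym (⁻¹-∙-comm _ _) ⟩
    - (suc m ×ₙ 1#) - (suc n ×ₙ 1#)    ∎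

  fromℤ-* : ∀ i j → fromℤ (i ℤ.* j) ≈ fromℤ i * fromℤ j
  fromℤ-* i j = begin
    fromℤ (i ℤ.* j)                                     ≈⟨ fromℤ-◃ s (∣ i ∣ ℕ.* ∣ j ∣) ⟩
    signed s ((∣ i ∣ ℕ.* ∣ j ∣) ×ₙ 1#)                  ≈⟨ signed-cong s (×1-homo-* ∣ i ∣ ∣ j ∣) ⟩
    signed s ((∣ i ∣ ×ₙ 1#) * (∣ j ∣ ×ₙ 1#))            ≈⟨ signed-* (sign i) (sign j) _ _ ⟩
    signed (sign i) (∣ i ∣ ×ₙ 1#) * signed (sign j) (∣ j ∣ ×ₙ 1#)
                                                        ≈⟨ sym (*-cong (fromℤ-signAbs i) (fromℤ-signAbs j)) ⟩
    fromℤ i * fromℤ j                                   ∎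
    where s = sign i Sign.* sign j

  fromℤ-neg : ∀ i → fromℤ (ℤ.- i) ≈ - fromℤ i
  fromℤ-neg (+ zero) = sym -0#≈0#
  fromℤ-neg (+ suc n) = refl
  fromℤ-neg -[1+ n ] = sym (-‿involutive _)

  ℤ⟶R : ACR._-Raw-AlmostCommutative⟶_ ℤ.+-*-rawRing (ACR.fromCommutativeRing R)
  ℤ⟶R = record
    { ⟦_⟧ = fromℤ ; +-homo = fromℤ-+ ; *-homo = fromℤ-* ; -‿homo = fromℤ-neg
    ; 0-homo = refl ; 1-homo = +-identityʳ 1# }

  fromℤ-≟ : ∀ i j → Maybe (fromℤ i ≈ fromℤ j)
  fromℤ-≟ i j with i ℤₚ.≟ j
  ... | yes ≡.refl = just refl
  ... | no _ = nothing

  open import Algebra.Solver.Ring ℤ.+-*-rawRing (ACR.fromCommutativeRing R) ℤ⟶R fromℤ-≟ public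

module _ {a ℓ : Level} (S : Setoid a ℓ) where
  open Setoid S

  lookup-injective : ∀ {xs} → Unique S xs → ∀ i j → lookup xs i ≈ lookup xs j → i ≡ j
  lookup-injective (_ ∷ _) zero zero _ = ≡.refl
  lookup-injective (x≉xs ∷ _) zero (suc j) x≈xsⱼ = contradiction x≈xsⱼ (All.lookup x≉xs (∈ₚ.∈-lookup j))
  lookup-injective (x≉xs ∷ _) (suc i) zero xsᵢ≈x = contradiction (sym xsᵢ≈x) (All.lookup x≉xs (∈ₚ.∈-lookup i))
  lookup-injective (_ ∷ xs-unique) (suc i) (suc j) xsᵢ≈xsⱼ = ≡.cong suc (lookup-injective xs-unique i j xsᵢ≈xsⱼ)

  ¬¬-all : ∀ {p} {P : Carrier → Set p} xs → (∀ x → ¬ ¬ P x) → ¬ ¬ All P xs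
  ¬¬-all [] _ k = k []
  ¬¬-all (x ∷ xs) ¬¬P k = ¬¬P x (λ px → ¬¬-all xs ¬¬P (λ pxs → k (px ∷ pxs)))

  ¬¬-∀-enumerated : ∀ {p} {P : Carrier → Set p} {xs} → P Respects _≈_ → IsEnumeration S xs →
                    (∀ x → ¬ ¬ P x) → ¬ ¬ (∀ x → P x)
  ¬¬-∀-enumerated {xs = xs} resp _∈xs ¬¬P =
    ¬¬-map (λ pxs x → All.lookupₛ S resp pxs (x ∈xs)) (¬¬-all xs ¬¬P)

  ¬¬-decidable : ∀ {xs} → IsEnumeration S xs → ¬ ¬ Decidable _≈_
  ¬¬-decidable enum =
    ¬¬-∀-enumerated (λ x≈x′ dec y → Dec.map′ (trans (sym x≈x′)) (trans x≈x′) (dec y)) enum λ x →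
    ¬¬-∀-enumerated (λ y≈y′ → Dec.map′ (λ x≈y → trans x≈y y≈y′) (λ x≈y′ → trans x≈y′ (sym y≈y′))) enum λ y →
    ¬¬-excluded-middle

module _ {r ℓ : Level} (R : CommutativeRing r ℓ) where
  open CommutativeRing R
  open FieldNotions R
  open IntegerCoefficients R using (solve; _:=_; _:+_; _:*_; _:-_; con)
  open import Relation.Binary.Reasoning.Setoid setoid

  twiceArea : Point → Point → Point → Carrier
  twiceArea (x₁ , x₂) (u₁ , u₂) (v₁ , v₂) = (x₁ - u₁) * (v₂ - u₂) - (x₂ - u₂) * (v₁ - u₁)

  heron : ∀ x u v → let A = dist x u ; B = dist x v ; D = dist u v in
          ((2 ·1) * twiceArea x u v) * ((2 ·1) * twiceArea x u v)
            ≈ (4 ·1) * A * D - (A + D - B) * (A + D - B)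
  heron (x₁ , x₂) (u₁ , u₂) (v₁ , v₂) = solve 6 (λ x₁ x₂ u₁ u₂ v₁ v₂ →
    let ‖_,_‖ = λ a b → a :* a :+ b :* b
        A = ‖ x₁ :- u₁ , x₂ :- u₂ ‖
        B = ‖ x₁ :- v₁ , x₂ :- v₂ ‖
        D = ‖ u₁ :- v₁ , u₂ :- v₂ ‖
        s = con (+ 2) :* ((x₁ :- u₁) :* (v₂ :- u₂) :- (x₂ :- u₂) :* (v₁ :- u₁))
    in s :* s := con (+ 4) :* A :* D :- (A :+ D :- B) :* (A :+ D :- B))
    refl x₁ x₂ u₁ u₂ v₁ v₂

  common-point⇒f-isSquare : ∀ {ρ x} u v → OnCircle ρ u x → OnCircle ρ v x → IsSquare (f ρ (dist u v))
  common-point⇒f-isSquare {ρ} {x} u v xu≈ρ xv≈ρ = (2 ·1) * twiceArea x u v , (begin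
    ((2 ·1) * twiceArea x u v) * ((2 ·1) * twiceArea x u v)  ≈⟨ heron x u v ⟩
    (4 ·1) * A * D - (A + D - B) * (A + D - B)                ≈⟨ +-cong (*-congʳ (*-congˡ xu≈ρ)) (-‿cong (*-cong A+D-B≈ρ+D-ρ A+D-B≈ρ+D-ρ)) ⟩
    (4 ·1) * ρ * D - (ρ + D - ρ) * (ρ + D - ρ)                ≈⟨ solve 2 (λ ρ D → con (+ 4) :* ρ :* D :- (ρ :+ D :- ρ) :* (ρ :+ D :- ρ) := D :* (con (+ 4) :* ρ :- D)) refl ρ D ⟩
    D * ((4 ·1) * ρ - D)                                      ∎)
    where
    A = dist x u
    B = dist x v
    D = dist u v
    A+D-B≈ρ+D-ρ : A + D - B ≈ ρ + D - ρ
    A+D-B≈ρ+D-ρ = +-cong (+-congʳ xu≈ρ) (-‿cong xv≈ρ)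

  ≈0⇒f-isSquare : ∀ ρ {D} → D ≈ 0# → IsSquare (f ρ D)
  ≈0⇒f-isSquare ρ {D} D≈0 = 0# , trans (zeroˡ 0#) (sym (trans (*-congʳ D≈0) (zeroˡ _)))

  ≈ₚ⇒dist≈0 : ∀ p q → p ≈ₚ q → dist p q ≈ 0#
  ≈ₚ⇒dist≈0 (p₁ , p₂) (q₁ , q₂) (p₁≈q₁ , p₂≈q₂) = begin
    (p₁ - q₁) * (p₁ - q₁) + (p₂ - q₂) * (p₂ - q₂)  ≈⟨ +-cong (*-cong q₁-q₁≈ q₁-q₁≈) (*-cong q₂-q₂≈ q₂-q₂≈) ⟩
    (q₁ - q₁) * (q₁ - q₁) + (q₂ - q₂) * (q₂ - q₂)  ≈⟨ solve 2 (λ a b → (a :- a) :* (a :- a) :+ (b :- b) :* (b :- b) := con (+ 0)) refl q₁ q₂ ⟩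
    0#                                             ∎
    where
    q₁-q₁≈ = +-congʳ p₁≈q₁
    q₂-q₂≈ = +-congʳ p₂≈q₂

  onCircle-+ : ∀ {ρ} (q : Point) a b → a * a + b * b ≈ ρ → OnCircle ρ q (proj₁ q + a , proj₂ q + b)
  onCircle-+ (q₁ , q₂) a b a²+b²≈ρ = trans
    (solve 4 (λ q₁ q₂ a b → (q₁ :+ a :- q₁) :* (q₁ :+ a :- q₁) :+ (q₂ :+ b :- q₂) :* (q₂ :+ b :- q₂) := a :* a :+ b :* b) refl q₁ q₂ a b)
    a²+b²≈ρ

module _ {r ℓ : Level} (F : CommutativeRing r ℓ) (isField : IsFieldR F) where
  open CommutativeRing F
  open IsFieldR isField
  open IntegerCoefficients F using (solve; _:=_; _:+_; _:*_; _:-_; con)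
  open import Algebra.Properties.Group +-group
    using (∙-cancelˡ; ⁻¹-injective; inverseˡ-unique; x∙y⁻¹≈ε⇒x≈y)
  open import Algebra.Properties.Ring ring using (-0#≈0#; -‿involutive)
  open import Relation.Binary.Reasoning.Setoid setoid

  x≉0∧x*y≈0⇒y≈0 : ∀ {x y} → x ≉ 0# → x * y ≈ 0# → y ≈ 0#
  x≉0∧x*y≈0⇒y≈0 {x} {y} x≉0 xy≈0 with inverse x x≉0
  ... | x⁻¹ , xx⁻¹≈1 = begin
    y                ≈⟨ sym (*-identityˡ y) ⟩
    1# * y           ≈⟨ *-congʳ (sym xx⁻¹≈1) ⟩
    (x * x⁻¹) * y    ≈⟨ solve 3 (λ x x⁻¹ y → (x :* x⁻¹) :* y := x⁻¹ :* (x :* y)) refl x x⁻¹ y ⟩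
    x⁻¹ * (x * y)    ≈⟨ *-congˡ xy≈0 ⟩
    x⁻¹ * 0#         ≈⟨ zeroʳ x⁻¹ ⟩
    0#               ∎

  x*x≈0⇒x≈0 : Decidable _≈_ → ∀ {x} → x * x ≈ 0# → x ≈ 0#
  x*x≈0⇒x≈0 _≟_ {x} xx≈0 with x ≟ 0#
  ... | yes x≈0 = x≈0
  ... | no x≉0 = x≉0∧x*y≈0⇒y≈0 x≉0 xx≈0

  x*x≈y*y⇒x≈-y : ∀ {x y} → x * x ≈ y * y → x ≉ y → x ≈ - y
  x*x≈y*y⇒x≈-y {x} {y} xx≈yy x≉y = inverseˡ-unique x y (x≉0∧x*y≈0⇒y≈0 x-y≉0 [x-y][x+y]≈0)
    where
    x-y≉0 : x - y ≉ 0#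
    x-y≉0 = x≉y ∘ x∙y⁻¹≈ε⇒x≈y x y
    [x-y][x+y]≈0 : (x - y) * (x + y) ≈ 0#
    [x-y][x+y]≈0 = begin
      (x - y) * (x + y)  ≈⟨ solve 2 (λ x y → (x :- y) :* (x :+ y) := x :* x :- y :* y) refl x y ⟩
      x * x - y * y      ≈⟨ +-congʳ xx≈yy ⟩
      y * y - y * y      ≈⟨ -‿inverseʳ _ ⟩
      0#                 ∎

  x-y≈x-z⇒y≈z : ∀ x {y z} → x - y ≈ x - z → y ≈ z
  x-y≈x-z⇒y≈z x x-y≈x-z = ⁻¹-injective (∙-cancelˡ x _ _ x-y≈x-z)

  x≈z-y⇒x+y≈z : ∀ {x y z} → x ≈ z - y → x + y ≈ z
  x≈z-y⇒x+y≈z {y = y} {z} x≈z-y = trans (+-congʳ x≈z-y) (solve 2 (λ z y → (z :- y) :+ y := z) refl z y)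

  module SumOfTwoSquares (_≟_ : Decidable _≈_) {xs : List Carrier} (enum : IsEnumeration setoid xs)
                    (c : Carrier) (no-rep : ∀ a b → a * a + b * b ≉ c) where

    decSetoid : DecSetoid r ℓ
    decSetoid = record { isDecEquivalence = record { isEquivalence = isEquivalence ; _≟_ = _≟_ } }

    zs : List Carrier
    zs = deduplicate _≟_ xs

    zs-enum : IsEnumeration setoid zs
    zs-enum = deduplicate⁺ decSetoid enum

    zs-unique : Unique setoid zs
    zs-unique = deduplicate-! decSetoid xs

    n : ℕ
    n = length zs

    rank : Carrier → Fin n
    rank x = Any.index (zs-enum x)

    rank-injective : ∀ {x y} → rank x ≡ rank y → x ≈ y
    rank-injective = index-injective setoid (zs-enum _) (zs-enum _)

    rank-cong : ∀ {x y} → x ≈ y → rank x ≡ rank y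
    rank-cong {x} {y} x≈y = lookup-injective setoid zs-unique (rank x) (rank y)
      (trans (sym (lookup-index (zs-enum x))) (trans x≈y (lookup-index (zs-enum y))))

    -- Positive picks one element of each pair {x, − x}. T sends the (q + 1)/2
    -- positive a to a² and the (q − 1)/2 others b to c − b²; if no a² + b² is c,
    -- these q values together with c are q + 1 distinct elements.
    Positive : Carrier → Set
    Positive x = rank x Fin.≤ rank (- x)

    Positive? : ∀ x → Dec (Positive x)
    Positive? x = rank x Fin.≤? rank (- x)

    T : Carrier → Carrier
    T x with Positive? x
    ... | yes _ = x * x
    ... | no _ = c - x * x

    rank-neg : ∀ {a b} → a ≈ - b → rank (- a) ≡ rank b
    rank-neg {b = b} a≈-b = rank-cong (trans (-‿cong a≈-b) (-‿involutive b))

    positive-antipodes : ∀ {a b} → a ≈ - b → Positive a → Positive b → a ≈ b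
    positive-antipodes a≈-b pos-a pos-b = rank-injective (Finₚ.≤-antisym
      (Finₚ.≤-trans pos-a (Finₚ.≤-reflexive (rank-neg a≈-b)))
      (Finₚ.≤-trans pos-b (Finₚ.≤-reflexive (≡.sym (rank-cong a≈-b)))))

    negative-antipodes : ∀ {a b} → a ≈ - b → ¬ Positive a → ¬ Positive b → ⊥
    negative-antipodes a≈-b neg-a neg-b = Finₚ.<-asym rank-b<rank-a rank-a<rank-b
      where
      rank-b<rank-a = ≡.subst (Fin._< rank _) (rank-neg a≈-b) (ℕₚ.≰⇒> neg-a)
      rank-a<rank-b = ≡.subst (Fin._< rank _) (≡.sym (rank-cong a≈-b)) (ℕₚ.≰⇒> neg-b)

    positive-zero : ∀ {a} → a ≈ 0# → Positive a
    positive-zero {a} a≈0 = Finₚ.≤-reflexive (rank-cong (trans a≈0 (sym (trans (-‿cong a≈0) -0#≈0#))))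

    T-injective : ∀ a b → T a ≈ T b → a ≈ b
    T-injective a b Ta≈Tb with a ≟ b | Positive? a | Positive? b
    ... | yes a≈b | _ | _ = a≈b
    ... | no a≉b | yes pos-a | yes pos-b =
      positive-antipodes (x*x≈y*y⇒x≈-y Ta≈Tb a≉b) pos-a pos-b
    ... | no a≉b | no neg-a | no neg-b =
      ⊥-elim (negative-antipodes (x*x≈y*y⇒x≈-y (x-y≈x-z⇒y≈z c Ta≈Tb) a≉b) neg-a neg-b)
    ... | no _ | yes _ | no _ = contradiction (x≈z-y⇒x+y≈z Ta≈Tb) (no-rep a b)
    ... | no _ | no _ | yes _ = contradiction (x≈z-y⇒x+y≈z (sym Ta≈Tb)) (no-rep b a)

    T≉c : ∀ a → T a ≉ c
    T≉c a Ta≈c with Positive? a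
    ... | yes _ = no-rep a 0# (trans (solve 1 (λ a → a :* a :+ con (+ 0) :* con (+ 0) := a :* a) refl a) Ta≈c)
    ... | no neg-a = neg-a (positive-zero (x*x≈0⇒x≈0 _≟_ (x-y≈x-z⇒y≈z c (trans Ta≈c (sym c-0≈c)))))
      where
      c-0≈c : c - 0# ≈ c
      c-0≈c = trans (+-congˡ -0#≈0#) (+-identityʳ c)

    candidates : Fin (suc n) → Carrier
    candidates zero = c
    candidates (suc i) = T (lookup zs i)

    absurd : ⊥
    absurd with Finₚ.pigeonhole (ℕₚ.n<1+n n) (rank ∘ candidates)
    ... | _ , zero , () , _
    ... | zero , suc j , _ , same-rank = T≉c (lookup zs j) (sym (rank-injective same-rank))
    ... | suc i , suc j , i<j , same-rank = Finₚ.<⇒≢ i<j (≡.cong suc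
      (lookup-injective setoid zs-unique i j (T-injective _ _ (rank-injective same-rank))))

  sum-of-two-squares : IsFinite F → ∀ c → ¬ ¬ (∃₂ λ a b → a * a + b * b ≈ c)
  sum-of-two-squares (xs , enum) c no-rep = ¬¬-decidable setoid enum λ _≟_ →
    SumOfTwoSquares.absurd _≟_ enum c (λ a b a²+b²≈c → no-rep (a , b , a²+b²≈c))

  open FieldNotions F

  oddCharacteristic⇒2≉0 : OddCharacteristic → 2 ·1 ≉ 0#
  oddCharacteristic⇒2≉0 (zero , (() , _) , _)
  oddCharacteristic⇒2≉0 (suc zero , (_ , 1+0≈0 , _) , _) _ = 1≉0 (trans (sym (+-identityʳ 1#)) 1+0≈0)
  oddCharacteristic⇒2≉0 (suc (suc zero) , _ , ())
  oddCharacteristic⇒2≉0 (suc (suc (suc _)) , (_ , _ , minimal) , _) = minimal 2 (s≤s z≤n) (s≤s (s≤s (s≤s z≤n)))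

  half : OddCharacteristic → ∃ λ h → h + h ≈ 1#
  half oddChar with inverse (2 ·1) (oddCharacteristic⇒2≉0 oddChar)
  ... | h , 2h≈1 = h , trans (solve 1 (λ h → h :+ h := con (+ 2) :* h) refl h) 2h≈1

  f-isSquare⇒common-point : ∀ {h} → h + h ≈ 1# → ∀ ρ u v → dist u v ≉ 0# → IsSquare (f ρ (dist u v)) →
                            ∃ λ x → OnCircle ρ u x × OnCircle ρ v x
  f-isSquare⇒common-point {h} 2h≈1 ρ (u₁ , u₂) (v₁ , v₂) D≉0 (s , s²≈f) with inverse (dist (u₁ , u₂) (v₁ , v₂)) D≉0
  ... | e , De≈1 = x , trans xu≈K K≈ρ , trans xv≈K+[D-2hD] (trans (+-congˡ D-2hD≈0) (trans (+-identityʳ K) K≈ρ))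
    where
    D = dist (u₁ , u₂) (v₁ , v₂)
    t = h * e * s
    x : Point
    x = u₁ + (h * (v₁ - u₁) - t * (v₂ - u₂)) , u₂ + (h * (v₂ - u₂) + t * (v₁ - u₁))
    K = h * h * D + t * t * D
    xu≈K : dist x (u₁ , u₂) ≈ K
    xu≈K = solve 6 (λ u₁ u₂ v₁ v₂ h t →
      let ‖_,_‖ = λ a b → a :* a :+ b :* b in
      ‖ u₁ :+ (h :* (v₁ :- u₁) :- t :* (v₂ :- u₂)) :- u₁ , u₂ :+ (h :* (v₂ :- u₂) :+ t :* (v₁ :- u₁)) :- u₂ ‖
        := h :* h :* ‖ u₁ :- v₁ , u₂ :- v₂ ‖ :+ t :* t :* ‖ u₁ :- v₁ , u₂ :- v₂ ‖)
      refl u₁ u₂ v₁ v₂ h t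
    xv≈K+[D-2hD] : dist x (v₁ , v₂) ≈ K + (D - (h + h) * D)
    xv≈K+[D-2hD] = solve 6 (λ u₁ u₂ v₁ v₂ h t →
      let ‖_,_‖ = λ a b → a :* a :+ b :* b in
      ‖ u₁ :+ (h :* (v₁ :- u₁) :- t :* (v₂ :- u₂)) :- v₁ , u₂ :+ (h :* (v₂ :- u₂) :+ t :* (v₁ :- u₁)) :- v₂ ‖
        := h :* h :* ‖ u₁ :- v₁ , u₂ :- v₂ ‖ :+ t :* t :* ‖ u₁ :- v₁ , u₂ :- v₂ ‖
           :+ (‖ u₁ :- v₁ , u₂ :- v₂ ‖ :- (h :+ h) :* ‖ u₁ :- v₁ , u₂ :- v₂ ‖))
      refl u₁ u₂ v₁ v₂ h t
    D-2hD≈0 : D - (h + h) * D ≈ 0#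
    D-2hD≈0 = trans (+-congˡ (-‿cong (trans (*-congʳ 2h≈1) (*-identityˡ D)))) (-‿inverseʳ D)
    K≈ρ : K ≈ ρ
    K≈ρ = begin
      h * h * D + t * t * D                               ≈⟨ solve 4 (λ h e s D → h :* h :* D :+ (h :* e :* s) :* (h :* e :* s) :* D := h :* h :* (D :+ e :* e :* (s :* s) :* D)) refl h e s D ⟩
      h * h * (D + e * e * (s * s) * D)                   ≈⟨ *-congˡ (+-congˡ (*-congʳ (*-congˡ s²≈f))) ⟩
      h * h * (D + e * e * (D * ((4 ·1) * ρ - D)) * D)    ≈⟨ solve 4 (λ h e D ρ → h :* h :* (D :+ e :* e :* (D :* (con (+ 4) :* ρ :- D)) :* D) := h :* h :* (D :+ (D :* e) :* (D :* e) :* (con (+ 4) :* ρ :- D))) refl h e D ρ ⟩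
      h * h * (D + (D * e) * (D * e) * ((4 ·1) * ρ - D))  ≈⟨ *-congˡ (+-congˡ (*-congʳ (*-cong De≈1 De≈1))) ⟩
      h * h * (D + 1# * 1# * ((4 ·1) * ρ - D))            ≈⟨ *-congˡ (+-congˡ (trans (*-congʳ (*-identityˡ 1#)) (*-identityˡ _))) ⟩
      h * h * (D + ((4 ·1) * ρ - D))                      ≈⟨ solve 3 (λ h D ρ → h :* h :* (D :+ (con (+ 4) :* ρ :- D)) := (h :+ h) :* (h :+ h) :* ρ) refl h D ρ ⟩
      (h + h) * (h + h) * ρ                               ≈⟨ *-congʳ (*-cong 2h≈1 2h≈1) ⟩
      1# * 1# * ρ                                         ≈⟨ trans (*-congʳ (*-identityˡ 1#)) (*-identityˡ ρ) ⟩
      ρ                                                   ∎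

  packing⇒simplexInS : OddCharacteristic → ∀ ρ k (u : Fin k → Point) → CirclePacking k ρ u → SimplexInS k ρ u
  packing⇒simplexInS oddChar ρ k u (_ , disjoint , nonzero) = distinct-centres , distances-in-S
    where
    distinct-centres : ∀ i j → i ≢ j → ¬ (u i ≈ₚ u j)
    distinct-centres i j i≢j uᵢ≈uⱼ = nonzero i j i≢j (≈ₚ⇒dist≈0 F (u i) (u j) uᵢ≈uⱼ)
    distances-in-S : ∀ i j → i ≢ j → InS ρ (dist (u i) (u j))
    distances-in-S i j i≢j f-square =
      let (h , 2h≈1) = half oddChar
          (x , on-uᵢ , on-uⱼ) = f-isSquare⇒common-point 2h≈1 ρ (u i) (u j) (nonzero i j i≢j) f-square
      in disjoint i j i≢j x (on-uᵢ , on-uⱼ)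

  simplexInS⇒packing : IsFinite F → ∀ ρ k (p : Fin k → Point) → SimplexInS k ρ p → CirclePacking k ρ p
  simplexInS⇒packing finite ρ k p (_ , in-S) = distinct , disjoint , nonzero
    where
    disjoint : PairwiseDisjointCircles ρ p
    disjoint i j i≢j x (on-pᵢ , on-pⱼ) = in-S i j i≢j (common-point⇒f-isSquare F (p i) (p j) on-pᵢ on-pⱼ)
    nonzero : NonzeroCenterDistances p
    nonzero i j i≢j D≈0 = in-S i j i≢j (≈0⇒f-isSquare F ρ D≈0)
    distinct : DistinctCircles ρ p
    distinct i j i≢j same-circle = sum-of-two-squares finite ρ λ where
      (a , b , a²+b²≈ρ) → let on-pᵢ = onCircle-+ F (p i) a b a²+b²≈ρ in
        disjoint i j i≢j _ (on-pᵢ , proj₁ (same-circle _) on-pᵢ)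

mainTheorem9 : {a ℓ : Level} (F : CommutativeRing a ℓ) → IsFieldR F → IsFinite F →
    FieldNotions.OddCharacteristic F →
    (c : CommutativeRing.Carrier F) → ¬ (CommutativeRing._≈_ F c (CommutativeRing.0# F)) →
    (k : ℕ) →
    ((∃ λ (u : Fin k → FieldNotions.Point F) → FieldNotions.CirclePacking F k c u)
      → (∃ λ (p : Fin k → FieldNotions.Point F) → FieldNotions.SimplexInS F k c p))
    × ((p : Fin k → FieldNotions.Point F) → FieldNotions.SimplexInS F k c p →
      FieldNotions.CirclePacking F k c p)
mainTheorem9 F isField finite oddChar c _ k =
  (λ (u , packing) → u , packing⇒simplexInS F isField oddChar c k u packing) ,
  simplexInS⇒packing F isField finite c k
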